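{- For all integers $g,h$ with $3\le g\le h$, $n(2,g,h)=2h-2$; that is, the minimum number of vertices of a connected graph $G$ with $\chi(G)=2$, $\Gamma(G)=g$ and $\psi(G)=h$ equals $2h-2$.
   Context: All graphs are finite, simple and undirected. A complete $k$-coloring of a graph $G=(V,E)$ is a map $\varphi:V\to\{1,\dots,k\}$, using all $k$ colors, such that adjacent vertices get different colors and for any two colors $i\neq j$ there is an edge between the color classes $i$ and $j$. $\chi(G)$ is the chromatic number; the achromatic number $\psi(G)$ is the maximum $k$ for which $G$ has a complete $k$-coloring. A Grundy coloring is a proper coloring $\varphi:V\to\{1,\dots,k\}$ such that every vertex $v$ has a neighbor of color $i$ for every $1\le i<\varphi(v)$; the Grundy number $\Gamma(G)$ is the largest $k$ for which $G$ has a Grundy coloring with $k$ colors. $n(f,g,h)$ is the minimum number of vertices of a connected graph with $\chi=f$, $\Gamma=g$, $\psi=h$. -}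

module Defs where

open import Data.Nat using (ℕ; _≤_; _<_)
open import Data.Fin using (Fin; toℕ)
open import Data.Bool using (Bool; true; false)
open import Data.Product using (Σ; ∃; _×_; _,_)
open import Relation.Binary.PropositionalEquality using (_≡_; _≢_)

record Graph (n : ℕ) : Set where
  field
    adj    : Fin n → Fin n → Bool
    sym    : ∀ u v → adj u v ≡ adj v u
    irrefl : ∀ v → adj v v ≡ false

open Graph public

Adj : ∀ {n} → Graph n → Fin n → Fin n → Set
Adj G u v = adj G u v ≡ true

data Reach {n : ℕ} (G : Graph n) : Fin n → Fin n → Set where
  here : ∀ {v} → Reach G v v
  step : ∀ {u v w} → Adj G u v → Reach G v w → Reach G u w

Connected : ∀ {n} → Graph n → Set
Connected {n} G = ∀ (u v : Fin n) → Reach G u v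

-- a coloring with colors Fin k (i.e. {1,…,k} shifted to {0,…,k-1})
Proper : ∀ {n k} → Graph n → (Fin n → Fin k) → Set
Proper {n} G φ = ∀ (u v : Fin n) → Adj G u v → φ u ≢ φ v

UsesAll : ∀ {n k} → (Fin n → Fin k) → Set
UsesAll {n} {k} φ = ∀ (i : Fin k) → ∃ λ (v : Fin n) → φ v ≡ i

Colorable : ∀ {n} → Graph n → ℕ → Set
Colorable {n} G k = Σ (Fin n → Fin k) λ φ → Proper G φ

CompleteColoring : ∀ {n} → Graph n → (k : ℕ) → (Fin n → Fin k) → Set
CompleteColoring {n} G k φ =
  Proper G φ × UsesAll φ ×
  (∀ (i j : Fin k) → i ≢ j →
     ∃ λ (u : Fin n) → ∃ λ (v : Fin n) → Adj G u v × φ u ≡ i × φ v ≡ j)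

HasCompleteColoring : ∀ {n} → Graph n → ℕ → Set
HasCompleteColoring {n} G k = Σ (Fin n → Fin k) (CompleteColoring G k)

GrundyColoring : ∀ {n} → Graph n → (k : ℕ) → (Fin n → Fin k) → Set
GrundyColoring {n} G k φ =
  Proper G φ × UsesAll φ ×
  (∀ (v : Fin n) (i : Fin k) → toℕ i < toℕ (φ v) →
     ∃ λ (u : Fin n) → Adj G v u × φ u ≡ i)

HasGrundyColoring : ∀ {n} → Graph n → ℕ → Set
HasGrundyColoring {n} G k = Σ (Fin n → Fin k) (GrundyColoring G k)

IsChromaticNumber : ∀ {n} → Graph n → ℕ → Set
IsChromaticNumber G k = Colorable G k × (∀ m → Colorable G m → k ≤ m)

IsGrundyNumber : ∀ {n} → Graph n → ℕ → Set
IsGrundyNumber G k = HasGrundyColoring G k × (∀ m → HasGrundyColoring G m → m ≤ k)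

IsAchromaticNumber : ∀ {n} → Graph n → ℕ → Set
IsAchromaticNumber G k = HasCompleteColoring G k × (∀ m → HasCompleteColoring G m → m ≤ k)

Realizes : ℕ → ℕ → ℕ → ℕ → Set
Realizes f g h n = Σ (Graph n) λ G →
  Connected G × IsChromaticNumber G f × IsGrundyNumber G g × IsAchromaticNumber G h

IsNFGH : ℕ → ℕ → ℕ → ℕ → Set
IsNFGH f g h N = Realizes f g h N × (∀ n → Realizes f g h n → N ≤ n)

module Submission where

-- Let G be bipartite with sides given by σ and let φ be a
-- complete h-coloring.  If two colors i ≠ j were both absent from one side,
-- the edge between the classes i and j would have both ends on the other
-- side; so each side misses at most one color, the map v ↦ (σ v, φ v) hits
-- all but at most two of the 2h pairs, and |V| ≥ 2h - 2.
--
-- Write g = t + 2 and h = m + 2 (1 ≤ t ≤ m).  The graph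
-- H(m, t) has sides A₀ … A_m and B₀ … B_m with A_I ~ B_K iff I = 0, K = 0,
-- I < K, or K < I ≤ t.  It is connected and bipartite, explicit colorings
-- give ψ ≥ m + 2 and Γ ≥ t + 2, and ψ ≤ m + 2 is the lower bound again.
-- For Γ ≤ t + 2: the top two colors of a Grundy coloring with ≥ t + 3 colors
-- lie on an edge A_a B_b; a color shared by both sides occurs on the B-side
-- only at indices 1 … t (an induced-matching argument), and a pigeonhole count
-- on {1, …, t} then rules out every position of a.

open import Defs hiding (sym)
open import Data.Nat
  using (ℕ; zero; suc; _+_; _*_; _∸_; _≤_; _<_; z≤n; s≤s; NonZero; >-nonZero)
open import Data.Nat.Properties
  using ( ≤-refl; ≤-reflexive; ≤-trans; <-trans; <-≤-trans; ≤-<-trans; <-irrefl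
        ; ≤-antisym; ≤-pred; n≤1+n; n<1+n; 1+n≰n; m≤n⇒m≤1+n; m<n⇒m<1+n
        ; <⇒≤; <⇒≱; ≰⇒>; ≮⇒≥; <⇒≢; >⇒≢; n≢0⇒n>0; <-cmp; _<?_; _≤?_
        ; suc-injective; suc-pred; +-comm; *-cancelˡ-≤; m≤n+o⇒m∸n≤o; m+n∸n≡m )
open import Data.Nat.Tactic.RingSolver using (solve-∀)
open import Data.Fin
  using (Fin; zero; suc; toℕ; fromℕ; fromℕ<; _↑ˡ_; _↑ʳ_; splitAt; combine; remQuot)
open import Data.Fin.Properties
  using ( _≟_; toℕ-fromℕ; toℕ-fromℕ<; toℕ-injective; toℕ<n; injective⇒≤
        ; splitAt-↑ˡ; splitAt-↑ʳ; join-splitAt; combine-remQuot; any? )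
open import Data.Product using (∃; _×_; _,_; proj₁; proj₂; uncurry)
open import Data.Sum using (_⊎_; inj₁; inj₂; [_,_]′)
open import Data.Bool using (Bool; false)
open import Data.Empty using (⊥; ⊥-elim)
open import Relation.Nullary using (¬_; Dec; yes; no; does)
open import Relation.Nullary.Decidable using (_×-dec_; ¬?; dec-true)
open import Relation.Binary.Definitions using (tri<; tri≈; tri>)
open import Relation.Binary.PropositionalEquality
  using (_≡_; _≢_; refl; sym; trans; cong; cong₂; subst; subst₂)

extend₂ : ∀ {n} {X : Set} → (Fin n → X) → X → X → Fin (n + 2) → X
extend₂ {n} f p q x with splitAt n x
... | inj₁ i          = f i
... | inj₂ zero       = p
... | inj₂ (suc zero) = q

extend₂-old : ∀ {n} {X : Set} (f : Fin n → X) p q i → extend₂ f p q (i ↑ˡ 2) ≡ f i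
extend₂-old {n} f p q i rewrite splitAt-↑ˡ n i 2 = refl

extend₂-first : ∀ {n} {X : Set} (f : Fin n → X) p q → extend₂ f p q (n ↑ʳ zero) ≡ p
extend₂-first {n} f p q rewrite splitAt-↑ʳ n 2 zero = refl

extend₂-second : ∀ {n} {X : Set} (f : Fin n → X) p q → extend₂ f p q (n ↑ʳ suc zero) ≡ q
extend₂-second {n} f p q rewrite splitAt-↑ʳ n 2 (suc zero) = refl

-- A surjection Fin a → Fin b forces b ≤ a (choose a right inverse).
surjective⇒≥ : ∀ {a b} (f : Fin a → Fin b) → (∀ y → ∃ λ x → f x ≡ y) → b ≤ a
surjective⇒≥ f onto = injective⇒≤ {f = λ y → proj₁ (onto y)} section-injective
  where
  section-injective : ∀ {y y′} → proj₁ (onto y) ≡ proj₁ (onto y′) → y ≡ y′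
  section-injective {y} {y′} eq =
    trans (sym (proj₂ (onto y))) (trans (cong f eq) (proj₂ (onto y′)))

almost-surjective⇒≤ : ∀ {n N} (f : Fin n → Fin N) (p q : Fin N) →
  (∀ y → y ≢ p → y ≢ q → ∃ λ x → f x ≡ y) → N ≤ n + 2
almost-surjective⇒≤ {n} f p q hits = surjective⇒≥ (extend₂ f p q) onto
  where
  onto : ∀ y → ∃ λ x → extend₂ f p q x ≡ y
  onto y with y ≟ p | y ≟ q
  ... | yes refl | _        = n ↑ʳ zero , extend₂-first f p q
  ... | no _     | yes refl = n ↑ʳ suc zero , extend₂-second f p q
  ... | no y≢p   | no y≢q   with hits y y≢p y≢q
  ...   | x , fx≡y = x ↑ˡ 2 , trans (extend₂-old f p q x) fx≡y

data Slot (n : ℕ) : Fin (n + 2) → Set where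
  old    : ∀ i → Slot n (i ↑ˡ 2)
  first  : Slot n (n ↑ʳ zero)
  second : Slot n (n ↑ʳ suc zero)

slot : ∀ {n} x → Slot n x
slot {n} x with splitAt n x | join-splitAt n 2 x
... | inj₁ i          | refl = old i
... | inj₂ zero       | refl = first
... | inj₂ (suc zero) | refl = second

bounded-injection⇒≤ : ∀ {a b} (f : Fin a → ℕ) → (∀ i → f i < b) →
  (∀ {i j} → f i ≡ f j → i ≡ j) → a ≤ b
bounded-injection⇒≤ f bound inj = injective⇒≤ {f = λ i → fromℕ< (bound i)} λ eq →
  inj (trans (sym (toℕ-fromℕ< _)) (trans (cong toℕ eq) (toℕ-fromℕ< _)))

injection-avoiding-two⇒≤ : ∀ {a b} (f : Fin a → ℕ) (p q : ℕ) →
  (∀ i → f i < b) → (∀ {i j} → f i ≡ f j → i ≡ j) →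
  p < b → q < b → p ≢ q → (∀ i → f i ≢ p) → (∀ i → f i ≢ q) → a + 2 ≤ b
injection-avoiding-two⇒≤ {a} {b} f p q bound inj p<b q<b p≢q f≢p f≢q =
  bounded-injection⇒≤ (extend₂ f p q) extended-bound extended-injective
  where
  extended-bound : ∀ x → extend₂ f p q x < b
  extended-bound x with slot x
  ... | old i  rewrite extend₂-old f p q i  = bound i
  ... | first  rewrite extend₂-first f p q  = p<b
  ... | second rewrite extend₂-second f p q = q<b

  extended-injective : ∀ {x y} → extend₂ f p q x ≡ extend₂ f p q y → x ≡ y
  extended-injective {x} {y} eq with slot x | slot y
  ... | old i  | old j  rewrite extend₂-old f p q i | extend₂-old f p q j = cong (_↑ˡ 2) (inj eq)
  ... | old i  | first  rewrite extend₂-old f p q i | extend₂-first f p q = ⊥-elim (f≢p i eq)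
  ... | old i  | second rewrite extend₂-old f p q i | extend₂-second f p q = ⊥-elim (f≢q i eq)
  ... | first  | old j  rewrite extend₂-first f p q | extend₂-old f p q j = ⊥-elim (f≢p j (sym eq))
  ... | first  | first  = refl
  ... | first  | second rewrite extend₂-first f p q | extend₂-second f p q = ⊥-elim (p≢q eq)
  ... | second | old j  rewrite extend₂-second f p q | extend₂-old f p q j = ⊥-elim (f≢q j (sym eq))
  ... | second | first  rewrite extend₂-second f p q | extend₂-first f p q = ⊥-elim (p≢q (sym eq))
  ... | second | second = refl

crowded-block : ∀ {t k} (f : Fin t → ℕ) → (∀ {i j} → f i ≡ f j → i ≡ j) →
  (∀ i → 1 ≤ f i) → (∀ i → f i ≤ t) → 1 ≤ k → k ≤ t → (∀ i → f i ≢ k) → ⊥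
crowded-block {t} {k} f inj 1≤f f≤t 1≤k k≤t f≢k =
  1+n≰n (subst (_≤ suc t) (+-comm t 2) t+2≤t+1)
  where
  t+2≤t+1 : t + 2 ≤ suc t
  t+2≤t+1 = injection-avoiding-two⇒≤ f 0 k (λ i → s≤s (f≤t i)) inj (s≤s z≤n) (s≤s k≤t)
    (λ 0≡k → <-irrefl 0≡k 1≤k) (λ i f≡0 → <-irrefl (sym f≡0) (1≤f i)) f≢k

reach-trans : ∀ {n} {G : Graph n} {u v w} → Reach G u v → Reach G v w → Reach G u w
reach-trans here       q = q
reach-trans (step e p) q = step e (reach-trans p q)

chromatic-number-two : ∀ {n} (G : Graph n) {u v : Fin n} →
  Adj G u v → Colorable G 2 → IsChromaticNumber G 2
chromatic-number-two G {u} {v} uv two = two , at-least-two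
  where
  at-least-two : ∀ k → Colorable G k → 2 ≤ k
  at-least-two zero          (φ , _)        with φ u
  ... | ()
  at-least-two (suc zero)    (φ , φ-proper) = ⊥-elim (φ-proper u v uv (Fin1-trivial (φ u) (φ v)))
    where
    Fin1-trivial : ∀ (x y : Fin 1) → x ≡ y
    Fin1-trivial zero zero = refl
  at-least-two (suc (suc k)) _              = s≤s (s≤s z≤n)

lower-neighbour : ∀ {n K} {G : Graph n} {φ : Fin n → Fin K} → GrundyColoring G K φ →
  ∀ v j → j < toℕ (φ v) → ∃ λ u → Adj G v u × toℕ (φ u) ≡ j
lower-neighbour {φ = φ} (_ , _ , below) v j j<φv
  with below v (fromℕ< (<-trans j<φv (toℕ<n (φ v))))
             (subst (_< toℕ (φ v)) (sym (toℕ-fromℕ< _)) j<φv)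
... | u , vu , φu≡j = u , vu , trans (cong toℕ φu≡j) (toℕ-fromℕ< _)

top-edge : ∀ {n K} {G : Graph n} {φ : Fin n → Fin (suc (suc K))} →
  GrundyColoring G (suc (suc K)) φ →
  ∃ λ u → ∃ λ w → Adj G u w × toℕ (φ u) ≡ suc K × toℕ (φ w) ≡ K
top-edge {n} {K} {G} {φ} grundy@(_ , uses-all , _) = top-vertex (uses-all (fromℕ (suc K)))
  where
  top-vertex : (∃ λ u → φ u ≡ fromℕ (suc K)) →
    ∃ λ u → ∃ λ w → Adj G u w × toℕ (φ u) ≡ suc K × toℕ (φ w) ≡ K
  top-vertex (u , φu≡top) =
    below-top (lower-neighbour {G = G} {φ = φ} grundy u K (≤-reflexive (sym φu≡K+1)))
    where
    φu≡K+1 : toℕ (φ u) ≡ suc K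
    φu≡K+1 = trans (cong toℕ φu≡top) (toℕ-fromℕ (suc K))
    below-top : (∃ λ w → Adj G u w × toℕ (φ w) ≡ K) →
      ∃ λ u → ∃ λ w → Adj G u w × toℕ (φ u) ≡ suc K × toℕ (φ w) ≡ K
    below-top (w , uw , φw≡K) = u , w , uw , φu≡K+1 , φw≡K

other-side : ∀ {s x y : Fin 2} → x ≢ s → y ≢ s → x ≡ y
other-side {_}        {zero}     {zero}     _   _   = refl
other-side {_}        {suc zero} {suc zero} _   _   = refl
other-side {zero}     {zero}     {suc zero} x≢s _   = ⊥-elim (x≢s refl)
other-side {suc zero} {zero}     {suc zero} _   y≢s = ⊥-elim (y≢s refl)
other-side {zero}     {suc zero} {zero}     _   y≢s = ⊥-elim (y≢s refl)
other-side {suc zero} {suc zero} {zero}     x≢s _   = ⊥-elim (x≢s refl)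

-- Each side misses at most one color, so the pairs
-- (side, color) of the vertices cover all but at most two of the
-- 2(k + 1) pairs.
module BipartiteCompleteColoring {n k : ℕ} (G : Graph n)
  (σ : Fin n → Fin 2) (σ-proper : Proper G σ)
  (φ : Fin n → Fin (suc k)) (complete : CompleteColoring G (suc k) φ) where

  Occurs : Fin 2 → Fin (suc k) → Set
  Occurs s i = ∃ λ v → σ v ≡ s × φ v ≡ i

  occurs? : ∀ s i → Dec (Occurs s i)
  occurs? s i = any? (λ v → (σ v ≟ s) ×-dec (φ v ≟ i))

  -- Two colors absent from side s must coincide: an edge joining their
  -- classes would have both ends on the other side.
  absent-unique : ∀ s i j → ¬ Occurs s i → ¬ Occurs s j → i ≡ j
  absent-unique s i j ¬i ¬j with i ≟ j
  ... | yes i≡j = i≡j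
  ... | no i≢j with proj₂ (proj₂ complete) i j i≢j
  ...   | u , v , uv , φu≡i , φv≡j =
    ⊥-elim (σ-proper u v uv (other-side (λ σu≡s → ¬i (u , σu≡s , φu≡i))
                                        (λ σv≡s → ¬j (v , σv≡s , φv≡j))))

  -- The color absent from side s (an arbitrary one if none is absent).
  absent : Fin 2 → Fin (suc k)
  absent s with any? (λ i → ¬? (occurs? s i))
  ... | yes (i , _) = i
  ... | no _        = zero

  occurs-unless-absent : ∀ s i → i ≢ absent s → Occurs s i
  occurs-unless-absent s i i≢absent with occurs? s i
  ... | yes occ = occ
  ... | no ¬occ with any? (λ i → ¬? (occurs? s i))
  ...   | yes (j , ¬occ′) = ⊥-elim (i≢absent (absent-unique s i j ¬occ ¬occ′))
  ...   | no none         = ⊥-elim (none (i , ¬occ))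

  code : Fin n → Fin (2 * suc k)
  code v = combine (σ v) (φ v)

  hole : Fin 2 → Fin (2 * suc k)
  hole s = combine s (absent s)

  codes-almost-onto : ∀ y → y ≢ hole zero → y ≢ hole (suc zero) →
    ∃ λ v → code v ≡ y
  codes-almost-onto y y≢hole₀ y≢hole₁ =
    covered (remQuot {2} (suc k) y) (combine-remQuot {2} (suc k) y)
    where
    covered : ∀ si → uncurry combine si ≡ y → ∃ λ v → code v ≡ y
    covered (s , i) eq with i ≟ absent s
    ... | no i≢absent with occurs-unless-absent s i i≢absent
    ...   | v , σv≡s , φv≡i = v , trans (cong₂ combine σv≡s φv≡i) eq
    covered (zero , i) eq     | yes i≡absent =
      ⊥-elim (y≢hole₀ (trans (sym eq) (cong (combine {2} zero) i≡absent)))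
    covered (suc zero , i) eq | yes i≡absent =
      ⊥-elim (y≢hole₁ (trans (sym eq) (cong (combine {2} (suc zero)) i≡absent)))

  vertex-bound : 2 * suc k ≤ n + 2
  vertex-bound = almost-surjective⇒≤ code _ _ codes-almost-onto

complete-coloring-bound : ∀ {n} (G : Graph n) k →
  Colorable G 2 → HasCompleteColoring G k → 2 * k ≤ n + 2
complete-coloring-bound G zero    _                _               = z≤n
complete-coloring-bound G (suc k) (σ , σ-proper) (φ , complete) =
  BipartiteCompleteColoring.vertex-bound G σ σ-proper φ complete

-- The bipartite graph with sides A₀ … A_{M-1} and B₀ … B_{M-1} in which
-- A_I ~ B_K exactly when R I K.  Vertices are numbered A first, then B.
module BipartiteGraph (M : ℕ) (R : ℕ → ℕ → Set) (R? : ∀ I K → Dec (R I K)) where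

  A B : Fin M → Fin (M + M)
  A i = i ↑ˡ M
  B k = M ↑ʳ k

  link : Fin M ⊎ Fin M → Fin M ⊎ Fin M → Bool
  link (inj₁ _) (inj₁ _) = false
  link (inj₁ i) (inj₂ k) = does (R? (toℕ i) (toℕ k))
  link (inj₂ k) (inj₁ i) = does (R? (toℕ i) (toℕ k))
  link (inj₂ _) (inj₂ _) = false

  link-sym : ∀ x y → link x y ≡ link y x
  link-sym (inj₁ _) (inj₁ _) = refl
  link-sym (inj₁ _) (inj₂ _) = refl
  link-sym (inj₂ _) (inj₁ _) = refl
  link-sym (inj₂ _) (inj₂ _) = refl

  link-irrefl : ∀ x → link x x ≡ false
  link-irrefl (inj₁ _) = refl
  link-irrefl (inj₂ _) = refl

  G : Graph (M + M)
  G = record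
    { adj    = λ u v → link (splitAt M u) (splitAt M v)
    ; sym    = λ u v → link-sym (splitAt M u) (splitAt M v)
    ; irrefl = λ v → link-irrefl (splitAt M v)
    }

  data Vertex : Fin (M + M) → Set where
    inA : ∀ i → Vertex (A i)
    inB : ∀ k → Vertex (B k)

  vertex : ∀ v → Vertex v
  vertex v with splitAt M v | join-splitAt M M v
  ... | inj₁ i | refl = inA i
  ... | inj₂ k | refl = inB k

  adj-sym : ∀ {u v} → Adj G u v → Adj G v u
  adj-sym {u} {v} uv = trans (Graph.sym G v u) uv

  AB-adj : ∀ {i k} → R (toℕ i) (toℕ k) → Adj G (A i) (B k)
  AB-adj {i} {k} r rewrite splitAt-↑ˡ M i M | splitAt-↑ʳ M M k = dec-true (R? _ _) r

  adj-AB : ∀ {i k} → Adj G (A i) (B k) → R (toℕ i) (toℕ k)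
  adj-AB {i} {k} ik rewrite splitAt-↑ˡ M i M | splitAt-↑ʳ M M k
    with R? (toℕ i) (toℕ k) | ik
  ... | yes r | _ = r
  ... | no _  | ()

  adj-BA : ∀ {i k} → Adj G (B k) (A i) → R (toℕ i) (toℕ k)
  adj-BA {i} {k} ki = adj-AB (adj-sym {B k} {A i} ki)

  ¬adj-AA : ∀ {i j} → ¬ Adj G (A i) (A j)
  ¬adj-AA {i} {j} ij rewrite splitAt-↑ˡ M i M | splitAt-↑ˡ M j M with ij
  ... | ()

  ¬adj-BB : ∀ {k l} → ¬ Adj G (B k) (B l)
  ¬adj-BB {k} {l} kl rewrite splitAt-↑ʳ M M k | splitAt-↑ʳ M M l with kl
  ... | ()

  paint : {X : Set} → (Fin M → X) → (Fin M → X) → Fin (M + M) → X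
  paint f g v = [ f , g ]′ (splitAt M v)

  paint-A : ∀ {X : Set} (f g : Fin M → X) i → paint f g (A i) ≡ f i
  paint-A f g i rewrite splitAt-↑ˡ M i M = refl

  paint-B : ∀ {X : Set} (f g : Fin M → X) k → paint f g (B k) ≡ g k
  paint-B f g k rewrite splitAt-↑ʳ M M k = refl

  side : Fin (M + M) → Fin 2
  side = paint (λ _ → zero) (λ _ → suc zero)

  side-proper : Proper G side
  side-proper u v uv with vertex u | vertex v
  ... | inA i | inA j = ⊥-elim (¬adj-AA uv)
  ... | inB k | inB l = ⊥-elim (¬adj-BB uv)
  ... | inA i | inB k = λ eq → 0≢1 (trans (sym (paint-A _ _ i)) (trans eq (paint-B _ _ k)))
    where 0≢1 : zero ≢ suc {1} zero
          0≢1 ()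
  ... | inB k | inA i = λ eq → 0≢1 (trans (sym (paint-A _ _ i)) (trans (sym eq) (paint-B _ _ k)))
    where 0≢1 : zero ≢ suc {1} zero
          0≢1 ()

  two-colorable : Colorable G 2
  two-colorable = side , side-proper

  -- If A_o is adjacent to all of B and B_o to all of A, then every vertex
  -- is joined to A_o by a walk of length at most two, both ways.
  connected : (o : Fin M) → (∀ k → R (toℕ o) (toℕ k)) → (∀ i → R (toℕ i) (toℕ o)) →
    Connected G
  connected o A-hub B-hub u v = reach-trans (to-hub u) (from-hub v)
    where
    to-hub : ∀ v → Reach G v (A o)
    to-hub v with vertex v
    ... | inA i = step (AB-adj (B-hub i)) (step (adj-sym (AB-adj (A-hub o))) here)
    ... | inB k = step (adj-sym (AB-adj (A-hub k))) here

    from-hub : ∀ v → Reach G (A o) v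
    from-hub v with vertex v
    ... | inA i = step (AB-adj (A-hub o)) (step (adj-sym (AB-adj (B-hub i))) here)
    ... | inB k = step (AB-adj (A-hub k)) here

  module IndexColoring (C : ℕ) (cA cB : ℕ → ℕ)
    (cA<C : ∀ I → I < M → cA I < C) (cB<C : ∀ K → K < M → cB K < C) where

    color : Fin (M + M) → Fin C
    color = paint (λ i → fromℕ< (cA<C (toℕ i) (toℕ<n i)))
                   (λ k → fromℕ< (cB<C (toℕ k) (toℕ<n k)))

    color-A : ∀ i → toℕ (color (A i)) ≡ cA (toℕ i)
    color-A i = trans (cong toℕ (paint-A _ _ i)) (toℕ-fromℕ< _)

    color-B : ∀ k → toℕ (color (B k)) ≡ cB (toℕ k)
    color-B k = trans (cong toℕ (paint-B _ _ k)) (toℕ-fromℕ< _)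

    A′ B′ : ∀ I → I < M → Fin (M + M)
    A′ I I<M = A (fromℕ< I<M)
    B′ K K<M = B (fromℕ< K<M)

    A′-color : ∀ {I} (I<M : I < M) {x : Fin C} → cA I ≡ toℕ x → color (A′ I I<M) ≡ x
    A′-color I<M eq = toℕ-injective (trans (color-A _) (trans (cong cA (toℕ-fromℕ< I<M)) eq))

    B′-color : ∀ {K} (K<M : K < M) {x : Fin C} → cB K ≡ toℕ x → color (B′ K K<M) ≡ x
    B′-color K<M eq = toℕ-injective (trans (color-B _) (trans (cong cB (toℕ-fromℕ< K<M)) eq))

    A′B′-adj : ∀ {I K} (I<M : I < M) (K<M : K < M) → R I K → Adj G (A′ I I<M) (B′ K K<M)
    A′B′-adj {I} {K} I<M K<M r = AB-adj (subst₂ R (sym (toℕ-fromℕ< I<M)) (sym (toℕ-fromℕ< K<M)) r)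

    proper : (∀ I K → I < M → K < M → R I K → cA I ≢ cB K) → Proper G color
    proper distinct u v uv with vertex u | vertex v
    ... | inA i | inA j = ⊥-elim (¬adj-AA uv)
    ... | inB k | inB l = ⊥-elim (¬adj-BB uv)
    ... | inA i | inB k = λ eq → distinct _ _ (toℕ<n i) (toℕ<n k) (adj-AB uv)
      (trans (sym (color-A i)) (trans (cong toℕ eq) (color-B k)))
    ... | inB k | inA i = λ eq → distinct _ _ (toℕ<n i) (toℕ<n k) (adj-BA uv)
      (trans (sym (color-A i)) (trans (cong toℕ (sym eq)) (color-B k)))

    uses-all : (∀ c → c < C → (∃ λ I → I < M × cA I ≡ c) ⊎ (∃ λ K → K < M × cB K ≡ c)) →
      UsesAll color
    uses-all onto x with onto (toℕ x) (toℕ<n x)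
    ... | inj₁ (I , I<M , eq) = A′ I I<M , A′-color I<M eq
    ... | inj₂ (K , K<M , eq) = B′ K K<M , B′-color K<M eq

    grundy : (∀ I → I < M → ∀ c → c < cA I → ∃ λ K → K < M × R I K × cB K ≡ c) →
             (∀ K → K < M → ∀ c → c < cB K → ∃ λ I → I < M × R I K × cA I ≡ c) →
             ∀ v x → toℕ x < toℕ (color v) → ∃ λ u → Adj G v u × color u ≡ x
    grundy below-A below-B v x x<v with vertex v
    ... | inA i with below-A (toℕ i) (toℕ<n i) (toℕ x) (subst (toℕ x <_) (color-A i) x<v)
    ...   | K , K<M , r , eq =
      B′ K K<M , AB-adj (subst (R (toℕ i)) (sym (toℕ-fromℕ< K<M)) r) , B′-color K<M eq
    grundy below-A below-B v x x<v | inB k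
      with below-B (toℕ k) (toℕ<n k) (toℕ x) (subst (toℕ x <_) (color-B k) x<v)
    ...   | I , I<M , r , eq =
      A′ I I<M , adj-sym (AB-adj (subst (λ J → R J (toℕ k)) (sym (toℕ-fromℕ< I<M)) r)) ,
      A′-color I<M eq

    Joined : Fin C → Fin C → Set
    Joined x y = ∃ λ u → ∃ λ v → Adj G u v × color u ≡ x × color v ≡ y

    joined-sym : ∀ {x y} → Joined x y → Joined y x
    joined-sym (u , v , uv , cu≡x , cv≡y) = v , u , adj-sym uv , cv≡y , cu≡x

    module _ (joined : ∀ c d → c < d → d < C → ∃ λ I → ∃ λ K → I < M × K < M × R I K ×
                         ((cA I ≡ c × cB K ≡ d) ⊎ (cA I ≡ d × cB K ≡ c))) where

      joined-ordered : ∀ x y → toℕ x < toℕ y → Joined x y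
      joined-ordered x y x<y with joined (toℕ x) (toℕ y) x<y (toℕ<n y)
      ... | I , K , I<M , K<M , r , inj₁ (eqx , eqy) =
        A′ I I<M , B′ K K<M , A′B′-adj I<M K<M r , A′-color I<M eqx , B′-color K<M eqy
      ... | I , K , I<M , K<M , r , inj₂ (eqy , eqx) = joined-sym
        (A′ I I<M , B′ K K<M , A′B′-adj I<M K<M r , A′-color I<M eqy , B′-color K<M eqx)

      complete : ∀ x y → x ≢ y → Joined x y
      complete x y x≢y with <-cmp (toℕ x) (toℕ y)
      ... | tri< x<y _ _ = joined-ordered x y x<y
      ... | tri≈ _ x≡y _ = ⊥-elim (x≢y (toℕ-injective x≡y))
      ... | tri> _ _ y<x = joined-sym (joined-ordered y x y<x)

-- Among the indices 1 … t this is "I ≠ K"; above t it is the half graph I < K.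
data Edge (t : ℕ) : ℕ → ℕ → Set where
  from-A₀    : ∀ {K} → Edge t 0 K
  from-B₀    : ∀ {I} → Edge t I 0
  ascending  : ∀ {I K} → I < K → Edge t I K
  descending : ∀ {I K} → K < I → I ≤ t → Edge t I K

edge? : ∀ t I K → Dec (Edge t I K)
edge? t zero    K       = yes from-A₀
edge? t (suc I) zero    = yes from-B₀
edge? t (suc I) (suc K) with suc I <? suc K | suc K <? suc I | suc I ≤? t
... | yes I<K | _       | _      = yes (ascending I<K)
... | no  I≮K | yes K<I | yes I≤t = yes (descending K<I I≤t)
... | no  I≮K | yes K<I | no  I≰t = no λ { (ascending I<K) → I≮K I<K ; (descending _ I≤t) → I≰t I≤t }
... | no  I≮K | no  K≮I | _       = no λ { (ascending I<K) → I≮K I<K ; (descending K<I _) → K≮I K<I }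

edge-irreflexive : ∀ {t I} → 1 ≤ I → ¬ Edge t I I
edge-irreflexive _ (ascending I<I)    = <-irrefl refl I<I
edge-irreflexive _ (descending I<I _) = <-irrefl refl I<I

edge-into-block : ∀ {t I K} → 1 ≤ I → 1 ≤ K → K ≤ t → Edge t I K → I ≤ t
edge-into-block ()  _   _   from-A₀
edge-into-block _   ()  _   from-B₀
edge-into-block _   _   K≤t (ascending I<K)    = ≤-trans (n≤1+n _) (<-≤-trans I<K K≤t)
edge-into-block _   _   _   (descending _ I≤t) = I≤t

induced-matching-index : ∀ {t I K I′ K′} → ¬ Edge t I K → Edge t I′ K → Edge t I K′ →
  ¬ Edge t I′ K′ → 1 ≤ K × K ≤ t
induced-matching-index {t} {I} {K} {I′} {K′} ¬IK I′K IK′ ¬I′K′ = positive K ¬IK , bounded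
  where
  positive : ∀ K → ¬ Edge t I K → 1 ≤ K
  positive zero    ¬IK = ⊥-elim (¬IK from-B₀)
  positive (suc K) _   = s≤s z≤n

  bounded : K ≤ t
  bounded with K ≤? t
  ... | yes K≤t = K≤t
  ... | no  K≰t = ⊥-elim (impossible I′K IK′)
    where
    t<K : t < K
    t<K = ≰⇒> K≰t
    K≤I : K ≤ I
    K≤I = ≮⇒≥ (λ I<K → ¬IK (ascending I<K))
    impossible : Edge t I′ K → Edge t I K′ → ⊥
    impossible from-A₀              _                  = ¬I′K′ from-A₀
    impossible from-B₀              _                  = ¬IK from-B₀
    impossible (descending K<I′ I′≤t) _                = <⇒≱ (<-trans t<K K<I′) I′≤t
    impossible (ascending _)        from-A₀            = ¬IK from-A₀
    impossible (ascending _)        from-B₀            = ¬I′K′ from-B₀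
    impossible (ascending I′<K)     (ascending I<K′)   =
      ¬I′K′ (ascending (<-≤-trans I′<K (≤-trans K≤I (<⇒≤ I<K′))))
    impossible (ascending _)        (descending _ I≤t) = <⇒≱ (<-≤-trans t<K K≤I) I≤t

-- H(m, t) has 2(m + 1) = 2(m + 2) - 2 vertices.
vertex-count : ∀ m → suc m + suc m + 2 ≡ 2 * suc (suc m)
vertex-count = solve-∀

module ExtremalGraph (m t : ℕ) (1≤t : 1 ≤ t) (t≤m : t ≤ m) where
  open BipartiteGraph (suc m) (Edge t) (edge? t) public

  H-connected : Connected G
  H-connected = connected zero (λ _ → from-A₀) (λ _ → from-B₀)

  H-chromatic : IsChromaticNumber G 2
  H-chromatic = chromatic-number-two G {A zero} {B zero} (AB-adj from-A₀) two-colorable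

  -- A complete coloring with m + 2 colors: A_{I+1} and B_{I+1} share color
  -- I (they are not adjacent); A₀ gets m and B₀ gets m + 1.
  achromaticA achromaticB : ℕ → ℕ
  achromaticA zero    = m
  achromaticA (suc I) = I
  achromaticB zero    = suc m
  achromaticB (suc K) = K

  achromaticA-bound : ∀ I → I < suc m → achromaticA I < suc (suc m)
  achromaticA-bound zero    _         = m<n⇒m<1+n (n<1+n m)
  achromaticA-bound (suc I) (s≤s I<m) = m≤n⇒m≤1+n (m≤n⇒m≤1+n I<m)

  achromaticB-bound : ∀ K → K < suc m → achromaticB K < suc (suc m)
  achromaticB-bound zero    _         = ≤-refl
  achromaticB-bound (suc K) (s≤s K<m) = m≤n⇒m≤1+n (m≤n⇒m≤1+n K<m)

  module Achromatic = IndexColoring (suc (suc m)) achromaticA achromaticB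
                                    achromaticA-bound achromaticB-bound

  -- Properness: equal colors occur only on A_{I+1}, B_{I+1}, never adjacent.
  achromatic-distinct : ∀ I K → I < suc m → K < suc m → Edge t I K →
    achromaticA I ≢ achromaticB K
  achromatic-distinct zero    zero    _         _         _    = <⇒≢ (n<1+n m)
  achromatic-distinct zero    (suc K) _         (s≤s K<m) _    = >⇒≢ K<m
  achromatic-distinct (suc I) zero    (s≤s I<m) _         _    = <⇒≢ (m<n⇒m<1+n I<m)
  achromatic-distinct (suc I) (suc K) _         _         edge refl =
    edge-irreflexive (s≤s z≤n) edge

  achromatic-onto : ∀ c → c < suc (suc m) →
    (∃ λ I → I < suc m × achromaticA I ≡ c) ⊎ (∃ λ K → K < suc m × achromaticB K ≡ c)
  achromatic-onto c c<m+2 with <-cmp c m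
  ... | tri< c<m _ _ = inj₁ (suc c , s≤s c<m , refl)
  ... | tri≈ _ refl _ = inj₁ (zero , s≤s z≤n , refl)
  ... | tri> _ _ m<c with ≤-antisym (≤-pred c<m+2) m<c
  ...   | refl = inj₂ (zero , s≤s z≤n , refl)

  achromatic-joined : ∀ c d → c < d → d < suc (suc m) →
    ∃ λ I → ∃ λ K → I < suc m × K < suc m × Edge t I K ×
      ((achromaticA I ≡ c × achromaticB K ≡ d) ⊎ (achromaticA I ≡ d × achromaticB K ≡ c))
  achromatic-joined c d c<d d<m+2 with <-cmp d m
  ... | tri< d<m _ _ =
    suc c , suc d , s≤s (<-trans c<d d<m) , s≤s d<m , ascending (s≤s c<d) , inj₁ (refl , refl)
  ... | tri≈ _ refl _ = zero , suc c , s≤s z≤n , s≤s c<d , from-A₀ , inj₂ (refl , refl)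
  ... | tri> _ _ m<d with ≤-antisym (≤-pred d<m+2) m<d
  ...   | refl with <-cmp c m
  ...     | tri< c<m _ _ = suc c , zero , s≤s c<m , s≤s z≤n , from-B₀ , inj₁ (refl , refl)
  ...     | tri≈ _ refl _ = zero , zero , s≤s z≤n , s≤s z≤n , from-A₀ , inj₁ (refl , refl)
  ...     | tri> _ _ m<c = ⊥-elim (<⇒≱ c<d m<c)

  H-complete : HasCompleteColoring G (suc (suc m))
  H-complete = Achromatic.color , Achromatic.proper achromatic-distinct ,
               Achromatic.uses-all achromatic-onto , Achromatic.complete achromatic-joined

  -- ψ ≤ m + 2 is the general lower bound, as H has 2(m + 1) vertices.
  H-achromatic : IsAchromaticNumber G (suc (suc m))
  H-achromatic = H-complete , λ k complete → *-cancelˡ-≤ 2 (subst (2 * k ≤_)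
    (vertex-count m) (complete-coloring-bound G k two-colorable complete))

  grundyA grundyB : ℕ → ℕ
  grundyA zero = suc t
  grundyA (suc I) with suc I ≤? t
  ... | yes _ = I
  ... | no  _ = 0
  grundyB zero = t
  grundyB (suc K) with suc K ≤? t
  ... | yes _ = K
  ... | no  _ = t

  grundyA-block : ∀ {I} → suc I ≤ t → grundyA (suc I) ≡ I
  grundyA-block {I} I<t with suc I ≤? t
  ... | yes _   = refl
  ... | no  I≮t = ⊥-elim (I≮t I<t)

  grundyB-block : ∀ {K} → suc K ≤ t → grundyB (suc K) ≡ K
  grundyB-block {K} K<t with suc K ≤? t
  ... | yes _   = refl
  ... | no  K≮t = ⊥-elim (K≮t K<t)

  grundyB≤t : ∀ K → grundyB K ≤ t
  grundyB≤t zero = ≤-refl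
  grundyB≤t (suc K) with suc K ≤? t
  ... | yes K<t = <⇒≤ K<t
  ... | no  _   = ≤-refl

  grundyA-bound : ∀ I → I < suc m → grundyA I < suc (suc t)
  grundyA-bound zero    _ = ≤-refl
  grundyA-bound (suc I) _ with suc I ≤? t
  ... | yes I<t = m<n⇒m<1+n (m<n⇒m<1+n I<t)
  ... | no  _   = s≤s z≤n

  grundyB-bound : ∀ K → K < suc m → grundyB K < suc (suc t)
  grundyB-bound K _ = m<n⇒m<1+n (s≤s (grundyB≤t K))

  module Grundy = IndexColoring (suc (suc t)) grundyA grundyB grundyA-bound grundyB-bound

  -- Properness: within the block equal colors sit on A_I, B_I (not
  -- adjacent); A-vertices above t (color 0) see no B_1 (color 0).
  grundy-distinct : ∀ I K → I < suc m → K < suc m → Edge t I K → grundyA I ≢ grundyB K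
  grundy-distinct zero K _ _ _ eq = <⇒≱ (s≤s (grundyB≤t K)) (≤-reflexive eq)
  grundy-distinct (suc I) K _ _ edge eq with suc I ≤? t
  grundy-distinct (suc I) zero    _ _ _    eq | yes I<t = <⇒≢ I<t eq
  grundy-distinct (suc I) (suc K) _ _ edge eq | yes I<t with suc K ≤? t
  ... | yes _ = edge-irreflexive (s≤s z≤n) (subst (λ J → Edge t (suc I) (suc J)) (sym eq) edge)
  ... | no  _ = <⇒≢ I<t eq
  grundy-distinct (suc I) zero    _ _ _    eq | no _ = <⇒≢ 1≤t eq
  grundy-distinct (suc I) (suc K) _ _ edge eq | no I≰t with suc K ≤? t
  ... | no  _   = <⇒≢ 1≤t eq
  ... | yes K<t = I≰t (edge-into-block (s≤s z≤n) (s≤s z≤n) K<t edge)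

  block-index : ∀ {I} → I ≤ t → I < suc m
  block-index I≤t = s≤s (≤-trans I≤t t≤m)

  grundy-below-A : ∀ I → I < suc m → ∀ c → c < grundyA I →
    ∃ λ K → K < suc m × Edge t I K × grundyB K ≡ c
  grundy-below-A zero _ c c<t+1 with <-cmp c t
  ... | tri< c<t _ _  = suc c , block-index c<t , from-A₀ , grundyB-block c<t
  ... | tri≈ _ refl _ = zero , s≤s z≤n , from-A₀ , refl
  ... | tri> _ _ t<c  = ⊥-elim (<⇒≱ t<c (≤-pred c<t+1))
  grundy-below-A (suc I) _ c c<I with suc I ≤? t
  ... | yes I<t = suc c , block-index c<t , descending (s≤s c<I) I<t , grundyB-block c<t
    where c<t : suc c ≤ t
          c<t = <-trans c<I I<t
  grundy-below-A (suc I) _ c () | no _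

  grundy-below-B : ∀ K → K < suc m → ∀ c → c < grundyB K →
    ∃ λ I → I < suc m × Edge t I K × grundyA I ≡ c
  grundy-below-B zero _ c c<t = suc c , block-index c<t , from-B₀ , grundyA-block c<t
  grundy-below-B (suc K) _ c c<gK with suc K ≤? t
  ... | yes K<t = suc c , block-index c<t , ascending (s≤s c<gK) , grundyA-block c<t
    where c<t : suc c ≤ t
          c<t = <-trans c<gK K<t
  ... | no  K≰t = suc c , block-index c<gK ,
                  ascending (s≤s (<-≤-trans c<gK (≤-pred (≰⇒> K≰t)))) , grundyA-block c<gK

  grundy-onto : ∀ c → c < suc (suc t) →
    (∃ λ I → I < suc m × grundyA I ≡ c) ⊎ (∃ λ K → K < suc m × grundyB K ≡ c)
  grundy-onto c c<t+2 with <-cmp c t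
  ... | tri< c<t _ _  = inj₁ (suc c , block-index c<t , grundyA-block c<t)
  ... | tri≈ _ refl _ = inj₂ (zero , s≤s z≤n , refl)
  ... | tri> _ _ t<c with ≤-antisym (≤-pred c<t+2) t<c
  ...   | refl = inj₁ (zero , s≤s z≤n , refl)

  H-grundy-coloring : HasGrundyColoring G (suc (suc t))
  H-grundy-coloring = Grundy.color , Grundy.proper grundy-distinct ,
    Grundy.uses-all grundy-onto , Grundy.grundy grundy-below-A grundy-below-B

  module GrundyBound {K : ℕ} (φ : Fin (suc m + suc m) → Fin K)
                     (grundy : GrundyColoring G K φ) where

    c : Fin (suc m + suc m) → ℕ
    c v = toℕ (φ v)

    c-proper : ∀ {u v} → Adj G u v → c u ≢ c v
    c-proper {u} {v} uv eq = proj₁ grundy u v uv (toℕ-injective eq)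

    neighbour-in-B : ∀ i j → j < c (A i) → ∃ λ k → Edge t (toℕ i) (toℕ k) × c (B k) ≡ j
    neighbour-in-B i j j<c with lower-neighbour {G = G} {φ = φ} grundy (A i) j j<c
    ... | u , iu , cu≡j with vertex u
    ...   | inA i′ = ⊥-elim (¬adj-AA {i} {i′} iu)
    ...   | inB k  = k , adj-AB iu , cu≡j

    neighbour-in-A : ∀ k j → j < c (B k) → ∃ λ i → Edge t (toℕ i) (toℕ k) × c (A i) ≡ j
    neighbour-in-A k j j<c with lower-neighbour {G = G} {φ = φ} grundy (B k) j j<c
    ... | u , ku , cu≡j with vertex u
    ...   | inB k′ = ⊥-elim (¬adj-BB {k} {k′} ku)
    ...   | inA i  = i , adj-BA ku , cu≡j

    -- If A_i and B_k share a positive color, then 1 ≤ k ≤ t: both have a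
    -- neighbour of color 0, and the four vertices form an induced matching.
    shared-color-block : ∀ i k → 1 ≤ c (B k) → c (A i) ≡ c (B k) → 1 ≤ toℕ k × toℕ k ≤ t
    shared-color-block i k 1≤ck ci≡ck
      with neighbour-in-A k 0 1≤ck | neighbour-in-B i 0 (subst (1 ≤_) (sym ci≡ck) 1≤ck)
    ... | i′ , i′k , ci′≡0 | k′ , ik′ , ck′≡0 =
      induced-matching-index (λ ik → c-proper (AB-adj ik) ci≡ck) i′k ik′
                             (λ i′k′ → c-proper (AB-adj i′k′) (trans ci′≡0 (sym ck′≡0)))

    -- An edge A_a B_b whose ends both have colors above t is impossible.
    module HighEdge (a b : Fin (suc m)) (t<ca : t < c (A a)) (t<cb : t < c (B b)) where

      -- A_a has a neighbour B_{x j} of color j + 1 for every j < t ...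
      rainbow : ∀ (j : Fin t) → ∃ λ k → Edge t (toℕ a) (toℕ k) × c (B k) ≡ suc (toℕ j)
      rainbow j = neighbour-in-B a (suc (toℕ j)) (≤-<-trans (toℕ<n j) t<ca)

      x : Fin t → Fin (suc m)
      x j = proj₁ (rainbow j)

      x-edge : ∀ j → Edge t (toℕ a) (toℕ (x j))
      x-edge j = proj₁ (proj₂ (rainbow j))

      x-color : ∀ j → c (B (x j)) ≡ suc (toℕ j)
      x-color j = proj₂ (proj₂ (rainbow j))

      x-injective : ∀ {j j′} → toℕ (x j) ≡ toℕ (x j′) → j ≡ j′
      x-injective {j} {j′} eq = toℕ-injective (suc-injective
        (trans (sym (x-color j)) (trans (cong (λ k → c (B k)) (toℕ-injective eq)) (x-color j′))))

      -- ... and, since B_b also sees the color j + 1 on side A, every x j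
      -- lies in {1, …, t}.
      x-block : ∀ j → 1 ≤ toℕ (x j) × toℕ (x j) ≤ t
      x-block j with neighbour-in-A b (suc (toℕ j)) (≤-<-trans (toℕ<n j) t<cb)
      ... | i , _ , ci≡j+1 =
        shared-color-block i (x j) (subst (1 ≤_) (sym (x-color j)) (s≤s z≤n))
                            (trans ci≡j+1 (sym (x-color j)))

      -- If 1 ≤ a ≤ t, the t indices x j lie in {1, …, t} ∖ {a}.
      a-not-in-block : 1 ≤ toℕ a → toℕ a ≤ t → ⊥
      a-not-in-block 1≤a a≤t =
        crowded-block (λ j → toℕ (x j)) x-injective (λ j → proj₁ (x-block j))
          (λ j → proj₂ (x-block j)) 1≤a a≤t
          (λ j xj≡a → edge-irreflexive 1≤a (subst (Edge t (toℕ a)) xj≡a (x-edge j)))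

      -- If a > t, A_a has no neighbour in {B_1, …, B_t}.
      a-not-above-block : t < toℕ a → ⊥
      a-not-above-block t<a = <⇒≱ t<a (edge-into-block (≤-trans 1≤t (<⇒≤ t<a))
        (proj₁ (x-block j₀)) (proj₂ (x-block j₀)) (x-edge j₀))
        where j₀ : Fin t
              j₀ = fromℕ< 1≤t

      -- If a = 0, the neighbour B_k of color t has neighbours of colors
      -- 0, …, t - 1, all in {A_1, …, A_t} ∖ {A_k}.
      a-not-zero : toℕ a ≡ 0 → ⊥
      a-not-zero a≡0 =
        crowded-block (λ j → toℕ (z j)) z-injective z-positive z≤t
          (proj₁ (x-block last)) (proj₂ (x-block last)) z≢k
        where
        instance
          t-nonZero : NonZero t
          t-nonZero = >-nonZero 1≤t
        last : Fin t
        last = fromℕ< (≤-reflexive (suc-pred t))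
        k : Fin (suc m)
        k = x last
        ck≡t : c (B k) ≡ t
        ck≡t = trans (x-color last) (trans (cong suc (toℕ-fromℕ< _)) (suc-pred t))
        neighbour : ∀ j → ∃ λ i → Edge t (toℕ i) (toℕ k) × c (A i) ≡ toℕ j
        neighbour j = neighbour-in-A k (toℕ j) (subst (toℕ j <_) (sym ck≡t) (toℕ<n j))
        z : Fin t → Fin (suc m)
        z j = proj₁ (neighbour j)
        z-color : ∀ j → c (A (z j)) ≡ toℕ j
        z-color j = proj₂ (proj₂ (neighbour j))
        z-injective : ∀ {j j′} → toℕ (z j) ≡ toℕ (z j′) → j ≡ j′
        z-injective {j} {j′} eq = toℕ-injective
          (trans (sym (z-color j)) (trans (cong (λ i → c (A i)) (toℕ-injective eq)) (z-color j′)))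
        z-positive : ∀ j → 1 ≤ toℕ (z j)
        z-positive j = n≢0⇒n>0 λ zj≡0 → <⇒≱ (<-trans (toℕ<n j) t<ca) (≤-reflexive (ca≡j zj≡0))
          where ca≡j : toℕ (z j) ≡ 0 → c (A a) ≡ toℕ j
                ca≡j zj≡0 = trans (cong (λ i → c (A i)) (toℕ-injective (trans a≡0 (sym zj≡0))))
                                  (z-color j)
        z≤t : ∀ j → toℕ (z j) ≤ t
        z≤t j = edge-into-block (z-positive j) (proj₁ (x-block last)) (proj₂ (x-block last))
                                (proj₁ (proj₂ (neighbour j)))
        z≢k : ∀ j → toℕ (z j) ≢ toℕ k
        z≢k j zj≡k = edge-irreflexive (proj₁ (x-block last))
          (subst (λ I → Edge t I (toℕ k)) zj≡k (proj₁ (proj₂ (neighbour j))))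

      impossible : ⊥
      impossible with toℕ a in a≡I
      ... | zero = a-not-zero a≡I
      ... | suc I with suc I ≤? t
      ...   | yes a≤t = a-not-in-block (subst (1 ≤_) (sym a≡I) (s≤s z≤n)) (subst (_≤ t) (sym a≡I) a≤t)
      ...   | no  a≰t = a-not-above-block (subst (t <_) (sym a≡I) (≰⇒> a≰t))

  -- In a Grundy coloring with K + 2 > t + 2 colors, the two top colors
  -- K + 1 and K lie on an edge A_a B_b, and both exceed t.
  no-high-grundy : ∀ {K} (φ : Fin (suc m + suc m) → Fin (suc (suc K))) →
    GrundyColoring G (suc (suc K)) φ → t < K → ⊥
  no-high-grundy φ grundy t<K with top-edge {G = G} {φ = φ} grundy
  ... | u , w , uw , cu≡K+1 , cw≡K with vertex u | vertex w
  ...   | inA i | inA j = ¬adj-AA {i} {j} uw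
  ...   | inB k | inB l = ¬adj-BB {k} {l} uw
  ...   | inA a | inB b = GrundyBound.HighEdge.impossible φ grundy a b
    (subst (t <_) (sym cu≡K+1) (m<n⇒m<1+n t<K)) (subst (t <_) (sym cw≡K) t<K)
  ...   | inB b | inA a = GrundyBound.HighEdge.impossible φ grundy a b
    (subst (t <_) (sym cw≡K) t<K) (subst (t <_) (sym cu≡K+1) (m<n⇒m<1+n t<K))

  H-grundy-bound : ∀ K → HasGrundyColoring G K → K ≤ suc (suc t)
  H-grundy-bound K coloring with K ≤? suc (suc t)
  ... | yes K≤t+2 = K≤t+2
  ... | no  K≰t+2 = ⊥-elim (too-many K coloring (≰⇒> K≰t+2))
    where
    too-many : ∀ K → HasGrundyColoring G K → suc (suc t) < K → ⊥
    too-many (suc (suc K)) (φ , grundy) (s≤s (s≤s t<K)) = no-high-grundy φ grundy t<K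

  H-realizes : Realizes 2 (suc (suc t)) (suc (suc m)) (suc m + suc m)
  H-realizes = G , H-connected , H-chromatic ,
               (H-grundy-coloring , H-grundy-bound) , H-achromatic

lower-bound : ∀ g h n → Realizes 2 g h n → 2 * h ∸ 2 ≤ n
lower-bound g h n (G , _ , (two-colorable , _) , _ , (complete , _)) =
  m≤n+o⇒m∸n≤o (2 * h) 2 (subst (2 * h ≤_) (+-comm n 2)
    (complete-coloring-bound G h two-colorable complete))

lemma1 : ∀ (g h : ℕ) → 3 ≤ g → g ≤ h → IsNFGH 2 g h (2 * h ∸ 2)
lemma1 (suc (suc t)) (suc (suc m)) (s≤s (s≤s 1≤t)) (s≤s (s≤s t≤m)) =
  subst (Realizes 2 (suc (suc t)) (suc (suc m))) vertices
        (ExtremalGraph.H-realizes m t 1≤t t≤m) ,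
  lower-bound (suc (suc t)) (suc (suc m))
  where
  vertices : suc m + suc m ≡ 2 * suc (suc m) ∸ 2
  vertices = trans (sym (m+n∸n≡m (suc m + suc m) 2)) (cong (_∸ 2) (vertex-count m))
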